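{- Let $N\ge1$, $s\ge 1$, $1\le i\le s$, and let $\tau$ be a permutation of length $k\le N-1$. Then for every $\sigma\in T^o([12\cdots k])$ one has $Q_i(g_\tau\cdot\sigma)=Q_i(\sigma)$, and if $\tau$ is eligible then $Q_i([12\cdots k])=Q_i(\tau)$. Consequently, for $\sigma\in T^o([12\cdots k])$ (and additionally for $\sigma=[12\cdots k]$ when $\tau$ is eligible): (a) $Q^o_i(g_\tau\cdot\sigma)=Q^o_i(\sigma)$; (b) $\bar Q_i(g_\tau\cdot\sigma)=\bar Q_i(\sigma)$; (c) if $\sigma$ and $\tau$ are eligible, then $\sigma$ is type $i$-positive if and only if $g_\tau\cdot\sigma$ is type $i$-positive.
   Context: Setting: $N$ applicants labeled $1,\dots,N$ by quality ($N$ best); interview order a uniformly random $\pi\in S_N$ revealed from the left, only relative orders observed; $s$ selections, each applicant irrevocably accepted (using a selection) or rejected; win if a selected applicant has value $N$. For $\pi$ of length $\ge k$, $\pi|_k\in S_k$ is the relabelling of its first $k$ entries by relative order; $\rho$ has $\sigma\in S_k$ as prefix if $\rho|_k=\sigma$; $\pi\in S_N$ is then $\sigma$-prefixed. $SD(\sigma)$, $Win(\sigma)$: number of $\sigma$-prefixed $\pi\in S_N$, resp. those with $\pi(k)=N$. A position is a left-to-right maximum if its value exceeds all values to its left; a permutation of length $\le N$ is eligible if its last position is a left-to-right maximum or it has length $N$. For $\sigma$ of length $k$, $1\le i\le s$: $Q_1(\sigma)=Win(\sigma)/SD(\sigma)$; $Q_i(\sigma)$ = probability of winning by accepting applicant $k$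 and playing optimally afterwards, conditioned on $\pi$ $\sigma$-prefixed and $i$ selections available when interviewing applicant $k$; $Q^o_i(\sigma)$ = probability of winning with the best strategy after deciding on applicant $k$, conditioned on $\pi$ $\sigma$-prefixed and $i$ selections still available right after interviewing applicant $k$; $\bar Q_i=\max\{Q_i,Q^o_i\}$; $\sigma$ is type $i$-positive if $Q_i(\sigma)\ge Q^o_i(\sigma)$. Prefix tree: $\bar T(\sigma)$ is the set of all permutations of length at most $N$ having $\sigma$ as a prefix (including $\sigma$), and $T^o(\sigma)=\bar T(\sigma)\setminus\{\sigma\}$. For $\tau$ of length $k$, $g_\tau:\bar T([12\cdots k])\to\bar T(\tau)$ rearranges the first $k$ entries of a permutation $\rho\in\bar T([12\cdots k])$ (whose first $k$ entries are increasing) so that their relative order becomes $\tau$, keeping the set of these values and all remaining entries fixed (e.g. $N=6$, $\tau=[132]$, $\rho=[245361]$ gives $g_\tau\cdot\rho=[254361]$); it is a bijection. -}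

module Defs where

open import Data.Bool using (Bool; true; false; _∧_)
open import Data.Nat as ℕ using (ℕ; zero; suc; _∸_; _<_; _<ᵇ_; _≡ᵇ_)
open import Data.List using (List; []; _∷_; map; upTo; length; take; drop; filterᵇ; concatMap; foldr; _++_; [_])
open import Data.List.Properties using (≡-dec)
open import Data.List.Relation.Unary.All using (All)
open import Data.List.Relation.Binary.Permutation.Propositional using (_↭_)
open import Data.Integer using (+_)
open import Data.Rational as ℚ using (ℚ; 0ℚ; _/_; _+_; _*_; _⊔_)
open import Data.Product using (Σ; ∃; _×_)
open import Data.Sum using (_⊎_)
open import Relation.Binary.PropositionalEquality using (_≡_)
open import Relation.Nullary.Decidable using (⌊_⌋)

-- Permutations are lists of naturals; a permutation of length k is a
-- rearrangement of [1,2,...,k] (value k = best among them).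

idPerm : ℕ → List ℕ
idPerm k = map suc (upTo k)

IsPerm : List ℕ → Set
IsPerm xs = xs ↭ idPerm (length xs)

insertions : ℕ → List ℕ → List (List ℕ)
insertions x [] = [ x ] ∷ []
insertions x (y ∷ ys) = (x ∷ y ∷ ys) ∷ map (y ∷_) (insertions x ys)

perms : ℕ → List (List ℕ)
perms zero = [] ∷ []
perms (suc n) = concatMap (insertions (suc n)) (perms n)

countBelow : ℕ → List ℕ → ℕ
countBelow x [] = 0
countBelow x (y ∷ ys) with y <ᵇ x
... | true  = suc (countBelow x ys)
... | false = countBelow x ys

std : List ℕ → List ℕ
std xs = map (λ x → suc (countBelow x xs)) xs

restrict : ℕ → List ℕ → List ℕ
restrict k π = std (take k π)

_==_ : List ℕ → List ℕ → Bool
xs == ys = ⌊ ≡-dec ℕ._≟_ xs ys ⌋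

hasPrefixᵇ : List ℕ → List ℕ → Bool
hasPrefixᵇ σ ρ = restrict (length σ) ρ == σ

-- entry at 1-based position k (0 if out of range)
at : List ℕ → ℕ → ℕ
at [] k = 0
at (x ∷ xs) zero = 0
at (x ∷ xs) (suc zero) = x
at (x ∷ xs) (suc (suc k)) = at xs (suc k)

SD : ℕ → List ℕ → ℕ
SD N σ = length (filterᵇ (hasPrefixᵇ σ) (perms N))

Win : ℕ → List ℕ → ℕ
Win N σ = length (filterᵇ (λ π → hasPrefixᵇ σ π ∧ (at π (length σ) ≡ᵇ N)) (perms N))

-- the ratio a/b as a rational (0 if b = 0; never used with b = 0)
frac : ℕ → ℕ → ℚ
frac a zero = 0ℚ
frac a (suc b) = (+ a) / suc b

sumℚ : List ℚ → ℚ
sumℚ = foldr _+_ 0ℚ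

children : List ℕ → List (List ℕ)
children σ = filterᵇ (hasPrefixᵇ σ) (perms (suc (length σ)))

-- QoF N i f σ : optimal winning probability from applicant |σ|+1 on,
-- with i selections available, conditioned on prefix σ; f = N - |σ| is fuel.
QoF : ℕ → ℕ → ℕ → List ℕ → ℚ
QoF N zero f σ = 0ℚ
QoF N (suc j) zero σ = 0ℚ
QoF N (suc j) (suc f) σ =
  sumℚ (map (λ ρ → frac (SD N ρ) (SD N σ) *
                   ((frac (Win N ρ) (SD N ρ) + QoF N j f ρ) ⊔ QoF N (suc j) f ρ))
            (children σ))

Qo : ℕ → ℕ → List ℕ → ℚ
Qo N i σ = QoF N i (N ∸ length σ) σ

-- Q_i(σ): accept applicant |σ| (win if it is N) and then play optimally
-- with the remaining i-1 selections
Q : ℕ → ℕ → List ℕ → ℚ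
Q N i σ = frac (Win N σ) (SD N σ) + Qo N (i ∸ 1) σ

Qbar : ℕ → ℕ → List ℕ → ℚ
Qbar N i σ = Q N i σ ⊔ Qo N i σ

Positive : ℕ → ℕ → List ℕ → Set
Positive N i σ = Qo N i σ ℚ.≤ Q N i σ

LastIsLRMax : List ℕ → Set
LastIsLRMax ρ = Σ (List ℕ) λ xs → Σ ℕ λ x → (ρ ≡ xs ++ [ x ]) × All (ℕ._< x) xs

Eligible : ℕ → List ℕ → Set
Eligible N ρ = LastIsLRMax ρ ⊎ length ρ ≡ N

InTo : ℕ → ℕ → List ℕ → Set
InTo N k ρ = IsPerm ρ × k < length ρ × length ρ ℕ.≤ N × restrict k ρ ≡ idPerm k

-- g_τ · ρ  (k = |τ|): the first k entries of ρ (increasing) are rearranged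
-- to have relative order τ; the rest is kept
gAct : List ℕ → List ℕ → List ℕ
gAct τ ρ = map (at (take (length τ) ρ)) τ ++ drop (length τ) ρ

{-# OPTIONS --safe #-}
-- For a prefix ρ of length m ≤ N, SD N ρ and Q^o_i(ρ) depend only on m, and Win N ρ only on m and on
-- whether the last entry of ρ is its maximum. Every permutation of length n+1 arises exactly once by
-- inserting n+1 into one of length n; following the prefix of length m+1 through this insertion gives
-- recursions for SD and Win in which the prefix enters only through these data. Q^o(σ) is a sum over the
-- one-step extensions ρ of σ of terms which, by induction on the number of remaining applicants, depend only
-- on whether ρ ends with its maximum, and the numbers of extensions of either kind are again prefix counts.
-- Finally g_τ keeps the length and the last entry of σ, and g_τ [1..k] = τ.
module Submission where

open import Defs
open import Data.Bool using (Bool; true; false; _∧_; not; if_then_else_)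
open import Data.Bool.Properties using (∧-identityʳ; ∧-zeroʳ)
open import Data.Nat
  using (ℕ; zero; suc; _+_; _*_; _∸_; _≤_; _≥_; _<_; z≤n; s≤s; s≤s⁻¹; z<s; s<s; s<s⁻¹; _≟_; _<?_; _≡ᵇ_; _<ᵇ_)
open import Data.Nat.Properties
open import Data.Nat.ListAction using (sum)
open import Data.Nat.ListAction.Properties using (sum-++)
open import Data.Nat.Tactic.RingSolver using (solve-∀)
open import Algebra.Bundles using (CommutativeMonoid)
import Algebra.Properties.CommutativeSemigroup as CommutativeSemigroupProperties
open import Data.List using (List; []; _∷_; [_]; _++_; length; map; take; drop; upTo; applyUpTo; concatMap; filterᵇ)
open import Data.List.Properties
  using (≡-dec; ∷-injectiveˡ; ∷-injectiveʳ; length-++; length-map; length-take; length-upTo; map-++; map-∘; map-upTo;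
         map-applyUpTo; upTo-∷ʳ; map-cong-local; map-id-local; take-all; drop-all; take++drop≡id; ++-identityʳ)
open import Data.List.Relation.Unary.All as All using (All; []; _∷_)
open import Data.List.Relation.Unary.All.Properties
  using (All¬⇒¬Any; take⁺; concat⁺; applyUpTo⁺₁) renaming (map⁺ to All-map⁺)
open import Data.List.Relation.Unary.Any using (here; there)
open import Data.List.Membership.Propositional using (_∈_; _∉_)
open import Data.List.Membership.Propositional.Properties using (∈-∃++; ∈-++⁻; ∈-++⁺ʳ)
open import Data.List.Relation.Binary.Permutation.Propositional using (_↭_; ↭-refl; ↭-sym; ↭-trans; ↭-reflexive)
open import Data.List.Relation.Binary.Permutation.Propositional.Properties
  using (↭-empty-inv; ∈-resp-↭; drop-mid; ↭-length; ++⁺ʳ) renaming (map⁺ to ↭-map⁺)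
open import Data.Rational using (ℚ; 0ℚ; +-0-rawMonoid) renaming (_+_ to _+ℚ_; _*_ to _*ℚ_; _⊔_ to _⊔ℚ_; _≤_ to _≤ℚ_)
import Data.Rational.Properties as ℚ
open import Algebra.Definitions.RawMonoid +-0-rawMonoid using () renaming (_×_ to _×ℚ_)
open import Data.Product using (_×_; _,_; proj₁; proj₂)
open import Data.Sum using (_⊎_; inj₁; inj₂)
open import Data.Empty using (⊥-elim)
open import Function using (_∘_)
open import Function.Bundles using (_⇔_; mk⇔)
open import Relation.Nullary using (yes; no)
open import Relation.Nullary.Decidable using (dec-true; dec-false; isYes≗does)
open import Relation.Binary.PropositionalEquality
  using (_≡_; _≢_; refl; sym; trans; cong; cong₂; subst; subst₂; ≢-sym; module ≡-Reasoning)

module ℕ+ = CommutativeSemigroupProperties +-commutativeSemigroup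
module ℚ+ = CommutativeSemigroupProperties (CommutativeMonoid.commutativeSemigroup ℚ.+-0-commutativeMonoid)

private variable
  A : Set

⟦_⟧ : Bool → ℕ
⟦ true  ⟧ = 1
⟦ false ⟧ = 0

≡ᵇ-refl : ∀ n → (n ≡ᵇ n) ≡ true
≡ᵇ-refl n = dec-true (n ≟ n) refl

≢⇒≡ᵇ-false : ∀ {m n} → m ≢ n → (m ≡ᵇ n) ≡ false
≢⇒≡ᵇ-false {m} {n} = dec-false (m ≟ n)

<⇒<ᵇ-true : ∀ {m n} → m < n → (m <ᵇ n) ≡ true
<⇒<ᵇ-true {m} {n} = dec-true (m <? n)

≤⇒<ᵇ-false : ∀ {m n} → n ≤ m → (m <ᵇ n) ≡ false
≤⇒<ᵇ-false {m} {n} n≤m = dec-false (m <? n) (≤⇒≯ n≤m)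

==-true : ∀ {xs ys} → xs ≡ ys → (xs == ys) ≡ true
==-true {xs} {ys} eq = trans (isYes≗does (≡-dec _≟_ xs ys)) (dec-true (≡-dec _≟_ xs ys) eq)

==-false : ∀ {xs ys} → xs ≢ ys → (xs == ys) ≡ false
==-false {xs} {ys} neq = trans (isYes≗does (≡-dec _≟_ xs ys)) (dec-false (≡-dec _≟_ xs ys) neq)

==-cong : ∀ {xs ys xs′ ys′} → (xs ≡ ys → xs′ ≡ ys′) → (xs′ ≡ ys′ → xs ≡ ys) →
          (xs == ys) ≡ (xs′ == ys′)
==-cong {xs} {ys} to from with ≡-dec _≟_ xs ys
... | yes eq  = sym (==-true (to eq))
... | no  neq = sym (==-false (neq ∘ from))

count : (A → Bool) → List A → ℕ
count P xs = sum (map (⟦_⟧ ∘ P) xs)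

length-filterᵇ : ∀ (P : A → Bool) xs → length (filterᵇ P xs) ≡ count P xs
length-filterᵇ P [] = refl
length-filterᵇ P (x ∷ xs) with P x
... | true  = cong suc (length-filterᵇ P xs)
... | false = length-filterᵇ P xs

count-++ : ∀ (P : A → Bool) xs ys → count P (xs ++ ys) ≡ count P xs + count P ys
count-++ P xs ys = trans (cong sum (map-++ (⟦_⟧ ∘ P) xs ys)) (sum-++ (map (⟦_⟧ ∘ P) xs) _)

count-concatMap : ∀ {B : Set} (P : B → Bool) (f : A → List B) xs →
                  count P (concatMap f xs) ≡ sum (map (count P ∘ f) xs)
count-concatMap P f [] = refl
count-concatMap P f (x ∷ xs) = trans (count-++ P (f x) _) (cong (count P (f x) +_) (count-concatMap P f xs))

count-∧ʳ : ∀ (P : A → Bool) b xs → count (λ x → P x ∧ b) xs ≡ (if b then count P xs else 0)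
count-∧ʳ P true  [] = refl
count-∧ʳ P false [] = refl
count-∧ʳ P true  (x ∷ xs) = cong₂ _+_ (cong ⟦_⟧ (∧-identityʳ (P x))) (count-∧ʳ P true xs)
count-∧ʳ P false (x ∷ xs) = cong₂ _+_ (cong ⟦_⟧ (∧-zeroʳ (P x))) (count-∧ʳ P false xs)

sum-map-linear : ∀ (P R : A → Bool) k xs →
                 sum (map (λ x → ⟦ P x ⟧ + k * ⟦ R x ⟧) xs) ≡ count P xs + k * count R xs
sum-map-linear P R k [] = sym (*-zeroʳ k)
sum-map-linear P R k (x ∷ xs) =
  trans (cong (⟦ P x ⟧ + k * ⟦ R x ⟧ +_) (sum-map-linear P R k xs)) (shuffle ⟦ P x ⟧ ⟦ R x ⟧ _ _ k)
  where
  shuffle : ∀ a b c d k → a + k * b + (c + k * d) ≡ a + c + k * (b + d)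
  shuffle = solve-∀

sumℚ-by-class : ∀ (P c : A → Bool) (h : A → ℚ) (H : Bool → ℚ) xs → All (λ x → h x ≡ H (c x)) xs →
  sumℚ (map h (filterᵇ P xs))
  ≡ count (λ x → P x ∧ c x) xs ×ℚ H true +ℚ count (λ x → P x ∧ not (c x)) xs ×ℚ H false
sumℚ-by-class P c h H []       []          = sym (ℚ.+-identityʳ 0ℚ)
sumℚ-by-class P c h H (x ∷ xs) (hx ∷ hxs) with P x | c x
... | true  | true  = trans (cong₂ _+ℚ_ hx (sumℚ-by-class P c h H xs hxs)) (sym (ℚ.+-assoc (H true) _ _))
... | true  | false = trans (cong₂ _+ℚ_ hx (sumℚ-by-class P c h H xs hxs))
                            (ℚ+.x∙yz≈y∙xz (H false) (count (λ x → P x ∧ c x) xs ×ℚ H true) _)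
... | false | _     = sumℚ-by-class P c h H xs hxs

countUpTo : ℕ → (ℕ → Bool) → ℕ
countUpTo zero    g = 0
countUpTo (suc n) g = ⟦ g 0 ⟧ + countUpTo n (g ∘ suc)

count-applyUpTo : ∀ (P : A → Bool) f n → count P (applyUpTo f n) ≡ countUpTo n (P ∘ f)
count-applyUpTo P f zero    = refl
count-applyUpTo P f (suc n) = cong (⟦ P (f 0) ⟧ +_) (count-applyUpTo P (f ∘ suc) n)

countUpTo-cong : ∀ n {g h} → (∀ p → p < n → g p ≡ h p) → countUpTo n g ≡ countUpTo n h
countUpTo-cong zero    eq = refl
countUpTo-cong (suc n) eq = cong₂ _+_ (cong ⟦_⟧ (eq 0 z<s)) (countUpTo-cong n (λ p p<n → eq (suc p) (s<s p<n)))

countUpTo-+ : ∀ m n g → countUpTo (m + n) g ≡ countUpTo m g + countUpTo n (g ∘ (m +_))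
countUpTo-+ zero    n g = refl
countUpTo-+ (suc m) n g = trans (cong (⟦ g 0 ⟧ +_) (countUpTo-+ m n (g ∘ suc))) (sym (+-assoc ⟦ g 0 ⟧ _ _))

countUpTo-const : ∀ n b → countUpTo n (λ _ → b) ≡ n * ⟦ b ⟧
countUpTo-const zero    b = refl
countUpTo-const (suc n) b = cong (⟦ b ⟧ +_) (countUpTo-const n b)

countUpTo-none : ∀ n {g} → (∀ p → p < n → g p ≡ false) → countUpTo n g ≡ 0
countUpTo-none n none = trans (countUpTo-cong n none) (trans (countUpTo-const n false) (*-zeroʳ n))

countUpTo-single : ∀ n q {g} → q < n → (∀ p → p < n → p ≢ q → g p ≡ false) → countUpTo n g ≡ ⟦ g q ⟧
countUpTo-single (suc n) zero {g} _ others =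
  trans (cong (⟦ g 0 ⟧ +_) (countUpTo-none n (λ p p<n → others (suc p) (s<s p<n) λ ()))) (+-identityʳ _)
countUpTo-single (suc n) (suc q) {g} q<n others =
  trans (cong (_+ countUpTo n (g ∘ suc)) (cong ⟦_⟧ (others 0 z<s λ ())))
        (countUpTo-single n q (s<s⁻¹ q<n) (λ p p<n p≢q → others (suc p) (s<s p<n) (p≢q ∘ suc-injective)))

insertAt : ℕ → A → List A → List A
insertAt zero    x ys       = x ∷ ys
insertAt (suc p) x []       = [ x ]
insertAt (suc p) x (y ∷ ys) = y ∷ insertAt p x ys

length-insertAt : ∀ p (x : A) ys → length (insertAt p x ys) ≡ suc (length ys)
length-insertAt zero    x ys       = refl
length-insertAt (suc p) x []       = refl
length-insertAt (suc p) x (y ∷ ys) = cong suc (length-insertAt p x ys)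

map-insertAt : ∀ {B : Set} (f : A → B) p x ys → map f (insertAt p x ys) ≡ insertAt p (f x) (map f ys)
map-insertAt f zero    x ys       = refl
map-insertAt f (suc p) x []       = refl
map-insertAt f (suc p) x (y ∷ ys) = cong (f y ∷_) (map-insertAt f p x ys)

All-insertAt : ∀ {P : A → Set} p {x ys} → P x → All P ys → All P (insertAt p x ys)
All-insertAt zero    px pys        = px ∷ pys
All-insertAt (suc p) px []         = px ∷ []
All-insertAt (suc p) px (py ∷ pys) = py ∷ All-insertAt p px pys

∈-insertAt : ∀ p (x : A) ys → x ∈ insertAt p x ys
∈-insertAt zero    x ys       = here refl
∈-insertAt (suc p) x []       = here refl
∈-insertAt (suc p) x (y ∷ ys) = there (∈-insertAt p x ys)

++-≡-insertAt : ∀ xs (x : A) ys → xs ++ x ∷ ys ≡ insertAt (length xs) x (xs ++ ys)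
++-≡-insertAt []       x ys = refl
++-≡-insertAt (z ∷ xs) x ys = cong (z ∷_) (++-≡-insertAt xs x ys)

insertions≡applyUpTo : ∀ x ys → insertions x ys ≡ applyUpTo (λ p → insertAt p x ys) (suc (length ys))
insertions≡applyUpTo x []       = refl
insertions≡applyUpTo x (y ∷ ys) = cong ((x ∷ y ∷ ys) ∷_) (begin
  map (y ∷_) (insertions x ys)                                      ≡⟨ cong (map (y ∷_)) (insertions≡applyUpTo x ys) ⟩
  map (y ∷_) (applyUpTo (λ p → insertAt p x ys) (suc (length ys)))  ≡⟨ map-applyUpTo (λ p → insertAt p x ys) (y ∷_) _ ⟩
  applyUpTo (λ p → y ∷ insertAt p x ys) (suc (length ys))           ∎)
  where open ≡-Reasoning

take-insertAt-≤ : ∀ m p (x : A) ys → p ≤ m → take (suc m) (insertAt p x ys) ≡ insertAt p x (take m ys)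
take-insertAt-≤ m       zero    x ys       _         = refl
take-insertAt-≤ zero    (suc p) x []       _         = refl
take-insertAt-≤ (suc m) (suc p) x []       _         = refl
take-insertAt-≤ (suc m) (suc p) x (y ∷ ys) (s≤s p≤m) = cong (y ∷_) (take-insertAt-≤ m p x ys p≤m)

take-insertAt-≥ : ∀ m p (x : A) ys → m ≤ p → p ≤ length ys → take m (insertAt p x ys) ≡ take m ys
take-insertAt-≥ zero    p       x ys       _         _           = refl
take-insertAt-≥ (suc m) (suc p) x (y ∷ ys) (s≤s m≤p) (s≤s p≤len) = cong (y ∷_) (take-insertAt-≥ m p x ys m≤p p≤len)

insertAt-injective : ∀ p q {x : A} {ys zs} → x ∉ ys → x ∉ zs → p ≤ length ys → q ≤ length zs →
                     insertAt p x ys ≡ insertAt q x zs → p ≡ q × ys ≡ zs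
insertAt-injective zero    zero                      _    _    _         _         refl = refl , refl
insertAt-injective zero    (suc q) {zs = []}         _    _    _         ()        _
insertAt-injective zero    (suc q) {zs = z ∷ zs}     _    x∉zs _         _         refl = ⊥-elim (x∉zs (here refl))
insertAt-injective (suc p) zero    {ys = []}         _    _    ()        _         _
insertAt-injective (suc p) zero    {ys = y ∷ ys}     x∉ys _    _         _         refl = ⊥-elim (x∉ys (here refl))
insertAt-injective (suc p) (suc q) {ys = []}         _    _    ()        _         _
insertAt-injective (suc p) (suc q) {ys = _ ∷ _} {[]} _    _    _         ()        _
insertAt-injective (suc p) (suc q) {ys = y ∷ ys} {z ∷ zs} x∉ys x∉zs (s≤s p≤) (s≤s q≤) eq
  with insertAt-injective p q (x∉ys ∘ there) (x∉zs ∘ there) p≤ q≤ (∷-injectiveʳ eq)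
... | refl , refl = refl , cong (_∷ ys) (∷-injectiveˡ eq)

All<⇒∉ : ∀ {x xs} → All (_< x) xs → x ∉ xs
All<⇒∉ xs<x = All¬⇒¬Any (All.map (λ y<x x≡y → <-irrefl (sym x≡y) y<x) xs<x)

countBelow-∷ : ∀ x y ys → countBelow x (y ∷ ys) ≡ ⟦ y <ᵇ x ⟧ + countBelow x ys
countBelow-∷ x y ys with y <ᵇ x
... | true  = refl
... | false = refl

countBelow-insertAt : ∀ y p x ys → countBelow y (insertAt p x ys) ≡ ⟦ x <ᵇ y ⟧ + countBelow y ys
countBelow-insertAt y zero    x ys       = countBelow-∷ y x ys
countBelow-insertAt y (suc p) x []       = countBelow-∷ y x []
countBelow-insertAt y (suc p) x (z ∷ ys) = begin
  countBelow y (z ∷ insertAt p x ys)                       ≡⟨ countBelow-∷ y z _ ⟩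
  ⟦ z <ᵇ y ⟧ + countBelow y (insertAt p x ys)              ≡⟨ cong (⟦ z <ᵇ y ⟧ +_) (countBelow-insertAt y p x ys) ⟩
  ⟦ z <ᵇ y ⟧ + (⟦ x <ᵇ y ⟧ + countBelow y ys)              ≡⟨ ℕ+.x∙yz≈y∙xz ⟦ z <ᵇ y ⟧ ⟦ x <ᵇ y ⟧ _ ⟩
  ⟦ x <ᵇ y ⟧ + (⟦ z <ᵇ y ⟧ + countBelow y ys)              ≡⟨ cong (⟦ x <ᵇ y ⟧ +_) (sym (countBelow-∷ y z ys)) ⟩
  ⟦ x <ᵇ y ⟧ + countBelow y (z ∷ ys)                       ∎
  where open ≡-Reasoning

countBelow-all< : ∀ x ys → All (_< x) ys → countBelow x ys ≡ length ys
countBelow-all< x []       []           = refl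
countBelow-all< x (y ∷ ys) (y<x ∷ ys<x) =
  trans (countBelow-∷ x y ys) (cong₂ _+_ (cong ⟦_⟧ (<⇒<ᵇ-true y<x)) (countBelow-all< x ys ys<x))

countBelow-≤ : ∀ y ys → countBelow y ys ≤ length ys
countBelow-≤ y []       = z≤n
countBelow-≤ y (z ∷ ys) rewrite countBelow-∷ y z ys with z <ᵇ y
... | true  = s≤s (countBelow-≤ y ys)
... | false = m≤n⇒m≤1+n (countBelow-≤ y ys)

countBelow-< : ∀ y ys → y ∈ ys → countBelow y ys < length ys
countBelow-< y (y ∷ ys) (here refl) rewrite countBelow-∷ y y ys | ≤⇒<ᵇ-false {y} ≤-refl = s≤s (countBelow-≤ y ys)
countBelow-< y (z ∷ ys) (there y∈ys) rewrite countBelow-∷ y z ys with z <ᵇ y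
... | true  = s≤s (countBelow-< y ys y∈ys)
... | false = m≤n⇒m≤1+n (countBelow-< y ys y∈ys)

std-< : ∀ ys → All (_< suc (length ys)) (std ys)
std-< ys = All-map⁺ (All.tabulate (λ {y} y∈ys → s≤s (countBelow-< y ys y∈ys)))

std-insertAt : ∀ p x ys → All (_< x) ys → std (insertAt p x ys) ≡ insertAt p (suc (length ys)) (std ys)
std-insertAt p x ys ys<x =
  trans (map-insertAt (λ y → suc (countBelow y (insertAt p x ys))) p x ys)
        (cong₂ (insertAt p) rank-x (map-cong-local (All.map rank-y ys<x)))
  where
  rank-x : suc (countBelow x (insertAt p x ys)) ≡ suc (length ys)
  rank-x = cong suc (trans (countBelow-insertAt x p x ys)
                           (cong₂ _+_ (cong ⟦_⟧ (≤⇒<ᵇ-false {x} ≤-refl)) (countBelow-all< x ys ys<x)))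
  rank-y : ∀ {y} → y < x → suc (countBelow y (insertAt p x ys)) ≡ suc (countBelow y ys)
  rank-y {y} y<x = cong suc (trans (countBelow-insertAt y p x ys)
                                   (cong (λ b → ⟦ b ⟧ + countBelow y ys) (≤⇒<ᵇ-false (<⇒≤ y<x))))

length-take-≤ : ∀ {m} (ys : List A) → m ≤ length ys → length (take m ys) ≡ m
length-take-≤ {m = m} ys m≤len = trans (length-take m ys) (m≤n⇒m⊓n≡m m≤len)

length-restrict : ∀ {m} ys → m ≤ length ys → length (restrict m ys) ≡ m
length-restrict {m} ys m≤len = trans (length-map _ (take m ys)) (length-take-≤ ys m≤len)

restrict-< : ∀ {m} ys → m ≤ length ys → All (_< suc m) (restrict m ys)
restrict-< {m} ys m≤len = subst (λ l → All (_< suc l) (restrict m ys)) (length-take-≤ ys m≤len) (std-< (take m ys))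

restrict-insertAt : ∀ {m p x} ys → p ≤ m → m ≤ length ys → All (_< x) ys →
                    restrict (suc m) (insertAt p x ys) ≡ insertAt p (suc m) (restrict m ys)
restrict-insertAt {m} {p} {x} ys p≤m m≤len ys<x = begin
  std (take (suc m) (insertAt p x ys))
    ≡⟨ cong std (take-insertAt-≤ m p x ys p≤m) ⟩
  std (insertAt p x (take m ys))
    ≡⟨ std-insertAt p x (take m ys) (take⁺ m ys<x) ⟩
  insertAt p (suc (length (take m ys))) (restrict m ys)
    ≡⟨ cong (λ l → insertAt p (suc l) (restrict m ys)) (length-take-≤ ys m≤len) ⟩
  insertAt p (suc m) (restrict m ys) ∎
  where open ≡-Reasoning

restrict-insertAt-≥ : ∀ {m p x} ys → m ≤ p → p ≤ length ys → restrict m (insertAt p x ys) ≡ restrict m ys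
restrict-insertAt-≥ {m} {p} {x} ys m≤p p≤len = cong std (take-insertAt-≥ m p x ys m≤p p≤len)

at-< : ∀ {x} ys j → All (_< suc x) ys → at ys j < suc x
at-< []       j             _           = z<s
at-< (y ∷ ys) zero          _           = z<s
at-< (y ∷ ys) (suc zero)    (y<x ∷ _)   = y<x
at-< (y ∷ ys) (suc (suc j)) (_ ∷ ys<x) = at-< ys (suc j) ys<x

at-insertAt-max : ∀ {x} p k ys → p ≤ length ys → All (_< suc x) ys →
                  (at (insertAt p (suc x) ys) (suc k) ≡ᵇ suc x) ≡ (p ≡ᵇ k)
at-insertAt-max {x} zero    zero    ys       _        _          = ≡ᵇ-refl x
at-insertAt-max     zero    (suc k) ys       _        ys<x       = ≢⇒≡ᵇ-false (<⇒≢ (at-< ys (suc k) ys<x))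
at-insertAt-max     (suc p) zero    (y ∷ ys) _        (y<x ∷ _)  = ≢⇒≡ᵇ-false (<⇒≢ y<x)
at-insertAt-max     (suc p) (suc k) (y ∷ ys) (s≤s p≤) (_ ∷ ys<x) = at-insertAt-max p k ys p≤ ys<x

at-applyUpTo : ∀ (f : ℕ → ℕ) n {i} → i < n → at (applyUpTo f n) (suc i) ≡ f i
at-applyUpTo f (suc n) {zero}  _   = refl
at-applyUpTo f (suc n) {suc i} i<n = at-applyUpTo (f ∘ suc) n (s<s⁻¹ i<n)

applyUpTo-at : ∀ ys → applyUpTo (λ i → at ys (suc i)) (length ys) ≡ ys
applyUpTo-at []       = refl
applyUpTo-at (y ∷ ys) = cong (y ∷_) (applyUpTo-at ys)

at-++-beyond : ∀ xs {ys zs} j → length xs ≡ length ys → length xs < j → at (xs ++ zs) j ≡ at (ys ++ zs) j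
at-++-beyond []       {[]}     j             _   _           = refl
at-++-beyond (x ∷ xs) {y ∷ ys} (suc (suc j)) len (s≤s len<j) = at-++-beyond xs {ys} (suc j) (suc-injective len) len<j

at-∷ʳ : ∀ xs (x : ℕ) → at (xs ++ [ x ]) (suc (length xs)) ≡ x
at-∷ʳ []       x = refl
at-∷ʳ (y ∷ xs) x = at-∷ʳ xs x

length-idPerm : ∀ n → length (idPerm n) ≡ n
length-idPerm n = trans (length-map suc (upTo n)) (length-upTo n)

idPerm-∷ʳ : ∀ n → idPerm (suc n) ≡ idPerm n ++ [ suc n ]
idPerm-∷ʳ n = trans (cong (map suc) (sym (upTo-∷ʳ n))) (map-++ suc (upTo n) [ n ])

at-idPerm : ∀ n {y} → y ≤ n → at (idPerm n) y ≡ y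
at-idPerm zero    {zero}  _   = refl
at-idPerm (suc n) {zero}  _   = refl
at-idPerm n       {suc i} i<n = trans (cong (λ l → at l (suc i)) (map-upTo suc n)) (at-applyUpTo suc n i<n)

map-at-idPerm : ∀ ys → map (at ys) (idPerm (length ys)) ≡ ys
map-at-idPerm ys = begin
  map (at ys) (map suc (upTo (length ys)))      ≡⟨ sym (map-∘ (upTo (length ys))) ⟩
  map (at ys ∘ suc) (upTo (length ys))          ≡⟨ map-upTo (at ys ∘ suc) (length ys) ⟩
  applyUpTo (at ys ∘ suc) (length ys)           ≡⟨ applyUpTo-at ys ⟩
  ys                                            ∎
  where open ≡-Reasoning

-- Permutations of 1..m in the form in which `perms` generates them: by successive insertion of a new maximum.
data Perm : ℕ → List ℕ → Set where
  []  : Perm 0 []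
  ins : ∀ {m σ} q → q ≤ m → Perm m σ → Perm (suc m) (insertAt q (suc m) σ)

Perm-length : ∀ {m σ} → Perm m σ → length σ ≡ m
Perm-length []                       = refl
Perm-length (ins {m} {σ} q _ σ-perm) = trans (length-insertAt q (suc m) σ) (cong suc (Perm-length σ-perm))

Perm-< : ∀ {m σ} → Perm m σ → All (_< suc m) σ
Perm-< []               = []
Perm-< (ins q _ σ-perm) = All-insertAt q ≤-refl (All.map m<n⇒m<1+n (Perm-< σ-perm))

Perm-max-∈ : ∀ {m τ} → Perm (suc m) τ → suc m ∈ τ
Perm-max-∈ (ins {m} {σ} q _ _) = ∈-insertAt q (suc m) σ

perms-Perm : ∀ n → All (Perm n) (perms n)
perms-Perm zero    = [] ∷ []
perms-Perm (suc n) = concat⁺ (All-map⁺ (All.map insertions-Perm (perms-Perm n)))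
  where
  insertions-Perm : ∀ {π} → Perm n π → All (Perm (suc n)) (insertions (suc n) π)
  insertions-Perm {π} π-perm rewrite insertions≡applyUpTo (suc n) π =
    applyUpTo⁺₁ _ (suc (length π)) (λ p<len → ins _ (subst (_ ≤_) (Perm-length π-perm) (s≤s⁻¹ p<len)) π-perm)

max∈idPerm : ∀ n → suc n ∈ idPerm (suc n)
max∈idPerm n = subst (suc n ∈_) (sym (idPerm-∷ʳ n)) (∈-++⁺ʳ (idPerm n) (here refl))

↭idPerm⇒Perm : ∀ n {xs} → xs ↭ idPerm n → Perm n xs
↭idPerm⇒Perm zero    xs↭ = subst (Perm 0) (sym (↭-empty-inv xs↭)) []
↭idPerm⇒Perm (suc n) xs↭ with ∈-∃++ (∈-resp-↭ (↭-sym xs↭) (max∈idPerm n))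
... | ys , zs , refl = subst (Perm (suc n)) (sym (++-≡-insertAt ys (suc n) zs)) (ins (length ys) ys≤n rest-perm)
  where
  rest-perm : Perm n (ys ++ zs)
  rest-perm = ↭idPerm⇒Perm n (subst (ys ++ zs ↭_) (++-identityʳ (idPerm n))
                (drop-mid ys (idPerm n) (subst (ys ++ suc n ∷ zs ↭_) (idPerm-∷ʳ n) xs↭)))
  ys≤n : length ys ≤ n
  ys≤n = subst (length ys ≤_) (trans (sym (length-++ ys)) (Perm-length rest-perm)) (m≤m+n (length ys) (length zs))

IsPerm⇒Perm : ∀ {xs} → IsPerm xs → Perm (length xs) xs
IsPerm⇒Perm = ↭idPerm⇒Perm _

count-perms-suc : ∀ n (P : List ℕ → Bool) (F : List ℕ → ℕ) →
                  (∀ {π} → Perm n π → countUpTo (suc n) (λ p → P (insertAt p (suc n) π)) ≡ F π) →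
                  count P (perms (suc n)) ≡ sum (map F (perms n))
count-perms-suc n P F per-π = begin
  count P (concatMap (insertions (suc n)) (perms n))  ≡⟨ count-concatMap P (insertions (suc n)) (perms n) ⟩
  sum (map (count P ∘ insertions (suc n)) (perms n))  ≡⟨ cong sum (map-cong-local (All.map by-insertions (perms-Perm n))) ⟩
  sum (map F (perms n))                               ∎
  where
  open ≡-Reasoning
  by-insertions : ∀ {π} → Perm n π → count P (insertions (suc n) π) ≡ F π
  by-insertions {π} π-perm = begin
    count P (insertions (suc n) π)                          ≡⟨ cong (count P) (insertions≡applyUpTo (suc n) π) ⟩
    count P (applyUpTo ins-π (suc (length π)))              ≡⟨ count-applyUpTo P ins-π (suc (length π)) ⟩
    countUpTo (suc (length π)) (P ∘ ins-π)                  ≡⟨ cong (λ l → countUpTo (suc l) (P ∘ ins-π)) (Perm-length π-perm) ⟩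
    countUpTo (suc n) (P ∘ ins-π)                           ≡⟨ per-π π-perm ⟩
    F π                                                     ∎
    where
    ins-π : ℕ → List ℕ
    ins-π p = insertAt p (suc n) π

-- Inserting the new maximum at p ≤ m turns the prefix of length m+1 into insertAt p (suc m) (restrict m π),
-- which is insertAt q (suc m) σ₀ only for p = q; inserting it further right leaves that prefix unchanged.
count-insertions : ∀ {n m q σ₀ π} → m ≤ n → q ≤ m → Perm m σ₀ → Perm n π → (c : ℕ → Bool) →
  countUpTo (suc n) (λ p → (restrict (suc m) (insertAt p (suc n) π) == insertAt q (suc m) σ₀) ∧ c p)
  ≡ ⟦ (restrict m π == σ₀) ∧ c q ⟧
    + countUpTo (n ∸ m) (λ p → (restrict (suc m) π == insertAt q (suc m) σ₀) ∧ c (suc m + p))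
count-insertions {n} {m} {q} {σ₀} {π} m≤n q≤m σ₀-perm π-perm c = begin
  countUpTo (suc n) g                                      ≡⟨ cong (λ l → countUpTo (suc l) g) (sym (m+[n∸m]≡n m≤n)) ⟩
  countUpTo (suc m + (n ∸ m)) g                            ≡⟨ countUpTo-+ (suc m) (n ∸ m) g ⟩
  countUpTo (suc m) g + countUpTo (n ∸ m) (g ∘ (suc m +_)) ≡⟨ cong₂ _+_ first-part tail-part ⟩
  ⟦ (restrict m π == σ₀) ∧ c q ⟧ + countUpTo (n ∸ m) (λ p → (restrict (suc m) π == σ) ∧ c (suc m + p)) ∎
  where
  open ≡-Reasoning
  σ = insertAt q (suc m) σ₀
  g : ℕ → Bool
  g p = (restrict (suc m) (insertAt p (suc n) π) == σ) ∧ c p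
  m≤len : m ≤ length π
  m≤len = subst (m ≤_) (sym (Perm-length π-perm)) m≤n
  inserted : ∀ {p} → p ≤ m → restrict (suc m) (insertAt p (suc n) π) ≡ insertAt p (suc m) (restrict m π)
  inserted p≤m = restrict-insertAt π p≤m m≤len (Perm-< π-perm)
  inserted-≡σ : ∀ {p} → p ≤ m → insertAt p (suc m) (restrict m π) ≡ σ → p ≡ q × restrict m π ≡ σ₀
  inserted-≡σ {p} p≤m = insertAt-injective p q (All<⇒∉ (restrict-< π m≤len)) (All<⇒∉ (Perm-< σ₀-perm))
    (subst (p ≤_) (sym (length-restrict π m≤len)) p≤m) (subst (q ≤_) (sym (Perm-length σ₀-perm)) q≤m)
  g-at-q : g q ≡ (restrict m π == σ₀) ∧ c q
  g-at-q = cong (_∧ c q) (trans (cong (_== σ) (inserted q≤m))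
                                (==-cong (proj₂ ∘ inserted-≡σ q≤m) (cong (insertAt q (suc m)))))
  g-elsewhere : ∀ p → p < suc m → p ≢ q → g p ≡ false
  g-elsewhere p p<m+1 p≢q = cong (_∧ c p) (trans (cong (_== σ) (inserted (s≤s⁻¹ p<m+1)))
                                                 (==-false (p≢q ∘ proj₁ ∘ inserted-≡σ (s≤s⁻¹ p<m+1))))
  first-part : countUpTo (suc m) g ≡ ⟦ (restrict m π == σ₀) ∧ c q ⟧
  first-part = trans (countUpTo-single (suc m) q (s≤s q≤m) g-elsewhere) (cong ⟦_⟧ g-at-q)
  beyond : ∀ {p} → p < n ∸ m → suc m + p ≤ length π
  beyond {p} p<n∸m = subst (_≤ length π) (cong suc (+-comm p m))
                       (subst (suc p + m ≤_) (sym (Perm-length π-perm)) (m≤o∸n⇒m+n≤o (suc p) m≤n p<n∸m))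
  tail-part : countUpTo (n ∸ m) (g ∘ (suc m +_)) ≡ countUpTo (n ∸ m) (λ p → (restrict (suc m) π == σ) ∧ c (suc m + p))
  tail-part = countUpTo-cong (n ∸ m) λ p p<n∸m →
    cong (λ l → (l == σ) ∧ c (suc m + p)) (restrict-insertAt-≥ π (m≤m+n (suc m) p) (beyond p<n∸m))

lastIsMaxᵇ : List ℕ → Bool
lastIsMaxᵇ ρ = at ρ (length ρ) ≡ᵇ length ρ

lastIsMaxᵇ-insertAt : ∀ {n p π} → p ≤ n → Perm n π → lastIsMaxᵇ (insertAt p (suc n) π) ≡ (p ≡ᵇ n)
lastIsMaxᵇ-insertAt {n} {p} {π} p≤n π-perm rewrite length-insertAt p (suc n) π | Perm-length π-perm =
  at-insertAt-max p n π (subst (p ≤_) (sym (Perm-length π-perm)) p≤n) (Perm-< π-perm)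

SDᵐ : ℕ → ℕ → List ℕ → ℕ
SDᵐ N m σ = count (λ π → restrict m π == σ) (perms N)

Winᵐ : ℕ → ℕ → List ℕ → ℕ
Winᵐ N m σ = count (λ π → (restrict m π == σ) ∧ (at π m ≡ᵇ N)) (perms N)

SD≡SDᵐ : ∀ N {m σ} → length σ ≡ m → SD N σ ≡ SDᵐ N m σ
SD≡SDᵐ N refl = length-filterᵇ _ (perms N)

Win≡Winᵐ : ∀ N {m σ} → length σ ≡ m → Win N σ ≡ Winᵐ N m σ
Win≡Winᵐ N refl = length-filterᵇ _ (perms N)

SDᵐ-suc : ∀ {n m q σ₀} → m ≤ n → q ≤ m → Perm m σ₀ →
          SDᵐ (suc n) (suc m) (insertAt q (suc m) σ₀) ≡ SDᵐ n m σ₀ + (n ∸ m) * SDᵐ n (suc m) (insertAt q (suc m) σ₀)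
SDᵐ-suc {n} {m} {q} {σ₀} m≤n q≤m σ₀-perm =
  trans (count-perms-suc n _ _ per-π)
        (sum-map-linear (λ π → restrict m π == σ₀) (λ π → restrict (suc m) π == σ) (n ∸ m) (perms n))
  where
  σ = insertAt q (suc m) σ₀
  per-π : ∀ {π} → Perm n π → countUpTo (suc n) (λ p → restrict (suc m) (insertAt p (suc n) π) == σ)
                              ≡ ⟦ restrict m π == σ₀ ⟧ + (n ∸ m) * ⟦ restrict (suc m) π == σ ⟧
  per-π {π} π-perm = begin
    countUpTo (suc n) (λ p → restrict (suc m) (insertAt p (suc n) π) == σ)
      ≡⟨ countUpTo-cong (suc n) {h = λ p → (restrict (suc m) (insertAt p (suc n) π) == σ) ∧ true}
                        (λ p _ → sym (∧-identityʳ _)) ⟩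
    countUpTo (suc n) (λ p → (restrict (suc m) (insertAt p (suc n) π) == σ) ∧ true)
      ≡⟨ count-insertions m≤n q≤m σ₀-perm π-perm (λ _ → true) ⟩
    ⟦ (restrict m π == σ₀) ∧ true ⟧ + countUpTo (n ∸ m) (λ _ → (restrict (suc m) π == σ) ∧ true)
      ≡⟨ cong₂ _+_ (cong ⟦_⟧ (∧-identityʳ _)) (countUpTo-const (n ∸ m) _) ⟩
    ⟦ restrict m π == σ₀ ⟧ + (n ∸ m) * ⟦ (restrict (suc m) π == σ) ∧ true ⟧
      ≡⟨ cong (λ b → ⟦ restrict m π == σ₀ ⟧ + (n ∸ m) * ⟦ b ⟧) (∧-identityʳ _) ⟩
    ⟦ restrict m π == σ₀ ⟧ + (n ∸ m) * ⟦ restrict (suc m) π == σ ⟧ ∎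
    where open ≡-Reasoning

Winᵐ-suc : ∀ {n m q σ₀} → m ≤ n → q ≤ m → Perm m σ₀ →
           Winᵐ (suc n) (suc m) (insertAt q (suc m) σ₀) ≡ (if q ≡ᵇ m then SDᵐ n m σ₀ else 0)
Winᵐ-suc {n} {m} {q} {σ₀} m≤n q≤m σ₀-perm =
  trans (count-perms-suc n _ _ per-π) (count-∧ʳ (λ π → restrict m π == σ₀) (q ≡ᵇ m) (perms n))
  where
  σ = insertAt q (suc m) σ₀
  per-π : ∀ {π} → Perm n π →
          countUpTo (suc n) (λ p → (restrict (suc m) (insertAt p (suc n) π) == σ)
                                   ∧ (at (insertAt p (suc n) π) (suc m) ≡ᵇ suc n))
          ≡ ⟦ (restrict m π == σ₀) ∧ (q ≡ᵇ m) ⟧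
  per-π {π} π-perm = begin
    countUpTo (suc n) (λ p → (restrict (suc m) (insertAt p (suc n) π) == σ)
                             ∧ (at (insertAt p (suc n) π) (suc m) ≡ᵇ suc n))
      ≡⟨ countUpTo-cong (suc n) (λ p p<n+1 → cong ((restrict (suc m) (insertAt p (suc n) π) == σ) ∧_)
                                 (at-insertAt-max p m π (p≤length (s≤s⁻¹ p<n+1)) (Perm-< π-perm))) ⟩
    countUpTo (suc n) (λ p → (restrict (suc m) (insertAt p (suc n) π) == σ) ∧ (p ≡ᵇ m))
      ≡⟨ count-insertions m≤n q≤m σ₀-perm π-perm (_≡ᵇ m) ⟩
    ⟦ (restrict m π == σ₀) ∧ (q ≡ᵇ m) ⟧
      + countUpTo (n ∸ m) (λ p → (restrict (suc m) π == σ) ∧ (suc m + p ≡ᵇ m))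
      ≡⟨ cong (⟦ (restrict m π == σ₀) ∧ (q ≡ᵇ m) ⟧ +_) (countUpTo-none (n ∸ m) λ p _ →
           trans (cong ((restrict (suc m) π == σ) ∧_) (≢⇒≡ᵇ-false (≢-sym (m≢1+m+n m)))) (∧-zeroʳ _)) ⟩
    ⟦ (restrict m π == σ₀) ∧ (q ≡ᵇ m) ⟧ + 0
      ≡⟨ +-identityʳ _ ⟩
    ⟦ (restrict m π == σ₀) ∧ (q ≡ᵇ m) ⟧ ∎
    where
    open ≡-Reasoning
    p≤length : ∀ {p} → p ≤ n → p ≤ length π
    p≤length = subst (_ ≤_) (sym (Perm-length π-perm))

SDᵐ-invariant : ∀ {n m σ σ′} → Perm m σ → Perm m σ′ → m ≤ n → SDᵐ n m σ ≡ SDᵐ n m σ′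
SDᵐ-invariant [] [] _ = refl
SDᵐ-invariant {suc n} {suc m} σ-perm@(ins q q≤m σ₀-perm) σ′-perm@(ins q′ q′≤m σ₀′-perm) (s≤s m≤n) = begin
  SDᵐ (suc n) (suc m) (insertAt q (suc m) _)          ≡⟨ SDᵐ-suc m≤n q≤m σ₀-perm ⟩
  SDᵐ n m _ + (n ∸ m) * SDᵐ n (suc m) _               ≡⟨ cong₂ _+_ (SDᵐ-invariant σ₀-perm σ₀′-perm m≤n) extensions ⟩
  SDᵐ n m _ + (n ∸ m) * SDᵐ n (suc m) _               ≡⟨ sym (SDᵐ-suc m≤n q′≤m σ₀′-perm) ⟩
  SDᵐ (suc n) (suc m) (insertAt q′ (suc m) _)         ∎
  where
  open ≡-Reasoning
  extensions : (n ∸ m) * SDᵐ n (suc m) (insertAt q (suc m) _) ≡ (n ∸ m) * SDᵐ n (suc m) (insertAt q′ (suc m) _)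
  extensions with m≤n⇒m<n∨m≡n m≤n
  ... | inj₁ m<n  = cong ((n ∸ m) *_) (SDᵐ-invariant σ-perm σ′-perm m<n)
  ... | inj₂ refl rewrite n∸n≡0 m = refl

Winᵐ-invariant : ∀ {n m σ σ′} → Perm m σ → Perm m σ′ → m ≤ n → lastIsMaxᵇ σ ≡ lastIsMaxᵇ σ′ →
                 Winᵐ n m σ ≡ Winᵐ n m σ′
Winᵐ-invariant [] [] _ _ = refl
Winᵐ-invariant {suc n} {suc m} (ins q q≤m σ₀-perm) (ins q′ q′≤m σ₀′-perm) (s≤s m≤n) same-last = begin
  Winᵐ (suc n) (suc m) (insertAt q (suc m) _)  ≡⟨ Winᵐ-suc m≤n q≤m σ₀-perm ⟩
  (if q ≡ᵇ m then SDᵐ n m _ else 0)            ≡⟨ cong₂ (λ b k → if b then k else 0) same-position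
                                                         (SDᵐ-invariant σ₀-perm σ₀′-perm m≤n) ⟩
  (if q′ ≡ᵇ m then SDᵐ n m _ else 0)           ≡⟨ sym (Winᵐ-suc m≤n q′≤m σ₀′-perm) ⟩
  Winᵐ (suc n) (suc m) (insertAt q′ (suc m) _) ∎
  where
  open ≡-Reasoning
  same-position : (q ≡ᵇ m) ≡ (q′ ≡ᵇ m)
  same-position = trans (sym (lastIsMaxᵇ-insertAt q≤m σ₀-perm)) (trans same-last (lastIsMaxᵇ-insertAt q′≤m σ₀′-perm))

SD-invariant : ∀ N {m ρ ρ′} → Perm m ρ → Perm m ρ′ → m ≤ N → SD N ρ ≡ SD N ρ′
SD-invariant N ρ-perm ρ′-perm m≤N =
  trans (SD≡SDᵐ N (Perm-length ρ-perm))
        (trans (SDᵐ-invariant ρ-perm ρ′-perm m≤N) (sym (SD≡SDᵐ N (Perm-length ρ′-perm))))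

Win-invariant : ∀ N {m ρ ρ′} → Perm m ρ → Perm m ρ′ → m ≤ N → lastIsMaxᵇ ρ ≡ lastIsMaxᵇ ρ′ →
                Win N ρ ≡ Win N ρ′
Win-invariant N ρ-perm ρ′-perm m≤N same-last =
  trans (Win≡Winᵐ N (Perm-length ρ-perm))
        (trans (Winᵐ-invariant ρ-perm ρ′-perm m≤N same-last) (sym (Win≡Winᵐ N (Perm-length ρ′-perm))))

children-insertions : ∀ {m q σ₀ π} → q ≤ m → Perm m σ₀ → Perm (suc m) π → (b : Bool → Bool) →
  countUpTo (suc (suc m)) (λ p → (restrict (suc m) (insertAt p (suc (suc m)) π) == insertAt q (suc m) σ₀)
                                 ∧ b (lastIsMaxᵇ (insertAt p (suc (suc m)) π)))
  ≡ ⟦ (restrict m π == σ₀) ∧ b false ⟧ + ⟦ (restrict (suc m) π == insertAt q (suc m) σ₀) ∧ b true ⟧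
children-insertions {m} {q} {σ₀} {π} q≤m σ₀-perm π-perm b = begin
  countUpTo (suc n) (λ p → (restrict n (insertAt p (suc n) π) == σ) ∧ b (lastIsMaxᵇ (insertAt p (suc n) π)))
    ≡⟨ countUpTo-cong (suc n) (λ p p<n+1 → cong (λ l → (restrict n (insertAt p (suc n) π) == σ) ∧ b l)
                                           (lastIsMaxᵇ-insertAt (s≤s⁻¹ p<n+1) π-perm)) ⟩
  countUpTo (suc n) (λ p → (restrict n (insertAt p (suc n) π) == σ) ∧ b (p ≡ᵇ n))
    ≡⟨ count-insertions (n≤1+n m) q≤m σ₀-perm π-perm (b ∘ (_≡ᵇ n)) ⟩
  ⟦ (restrict m π == σ₀) ∧ b (q ≡ᵇ n) ⟧ + countUpTo (n ∸ m) (λ p → (restrict n π == σ) ∧ b (n + p ≡ᵇ n))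
    ≡⟨ cong₂ _+_ (cong (λ l → ⟦ (restrict m π == σ₀) ∧ b l ⟧) (≢⇒≡ᵇ-false (<⇒≢ (s≤s q≤m))))
                 (cong (λ l → countUpTo l (λ p → (restrict n π == σ) ∧ b (n + p ≡ᵇ n))) (m+n∸n≡m 1 m)) ⟩
  ⟦ (restrict m π == σ₀) ∧ b false ⟧ + (⟦ (restrict n π == σ) ∧ b (n + 0 ≡ᵇ n) ⟧ + 0)
    ≡⟨ cong (⟦ (restrict m π == σ₀) ∧ b false ⟧ +_)
            (trans (+-identityʳ _) (cong (λ l → ⟦ (restrict n π == σ) ∧ b l ⟧)
                                         (trans (cong (_≡ᵇ n) (+-identityʳ n)) (≡ᵇ-refl n)))) ⟩
  ⟦ (restrict m π == σ₀) ∧ b false ⟧ + ⟦ (restrict n π == σ) ∧ b true ⟧ ∎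
  where
  open ≡-Reasoning
  n = suc m
  σ = insertAt q n σ₀

children-lastIsMax : ∀ {m q σ₀} → q ≤ m → Perm m σ₀ →
  count (λ ρ → (restrict (suc m) ρ == insertAt q (suc m) σ₀) ∧ lastIsMaxᵇ ρ) (perms (suc (suc m)))
  ≡ SDᵐ (suc m) (suc m) (insertAt q (suc m) σ₀)
children-lastIsMax q≤m σ₀-perm = count-perms-suc _ _ _ λ π-perm →
  trans (children-insertions q≤m σ₀-perm π-perm (λ b → b))
        (cong₂ _+_ (cong ⟦_⟧ (∧-zeroʳ _)) (cong ⟦_⟧ (∧-identityʳ _)))

children-¬lastIsMax : ∀ {m q σ₀} → q ≤ m → Perm m σ₀ →
  count (λ ρ → (restrict (suc m) ρ == insertAt q (suc m) σ₀) ∧ not (lastIsMaxᵇ ρ)) (perms (suc (suc m)))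
  ≡ SDᵐ (suc m) m σ₀
children-¬lastIsMax q≤m σ₀-perm = count-perms-suc _ _ _ λ π-perm →
  trans (children-insertions q≤m σ₀-perm π-perm not)
        (trans (cong₂ _+_ (cong ⟦_⟧ (∧-identityʳ _)) (cong ⟦_⟧ (∧-zeroʳ _))) (+-identityʳ _))

childTerm : ℕ → ℕ → ℕ → ℕ → List ℕ → ℚ
childTerm N j f s ρ = frac (SD N ρ) s *ℚ ((frac (Win N ρ) (SD N ρ) +ℚ QoF N j f ρ) ⊔ℚ QoF N (suc j) f ρ)

QoF-by-class : ∀ N j f {m q σ₀} → q ≤ m → Perm m σ₀ → (H : Bool → ℚ) →
  (∀ {ρ} → Perm (suc (suc m)) ρ → childTerm N j f (SD N (insertAt q (suc m) σ₀)) ρ ≡ H (lastIsMaxᵇ ρ)) →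
  QoF N (suc j) (suc f) (insertAt q (suc m) σ₀)
  ≡ SDᵐ (suc m) (suc m) (insertAt q (suc m) σ₀) ×ℚ H true +ℚ SDᵐ (suc m) m σ₀ ×ℚ H false
QoF-by-class N j f {m} {q} {σ₀} q≤m σ₀-perm H by-class = begin
  sumℚ (map term (filterᵇ (λ ρ → restrict (length σ) ρ == σ) (perms (suc (length σ)))))
    ≡⟨ cong (λ l → sumℚ (map term (filterᵇ (λ ρ → restrict l ρ == σ) (perms (suc l))))) (Perm-length σ-perm) ⟩
  sumℚ (map term (filterᵇ (λ ρ → restrict (suc m) ρ == σ) (perms (suc (suc m)))))
    ≡⟨ sumℚ-by-class _ lastIsMaxᵇ term H (perms (suc (suc m))) (All.map by-class (perms-Perm (suc (suc m)))) ⟩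
  count (λ ρ → (restrict (suc m) ρ == σ) ∧ lastIsMaxᵇ ρ) (perms (suc (suc m))) ×ℚ H true
    +ℚ count (λ ρ → (restrict (suc m) ρ == σ) ∧ not (lastIsMaxᵇ ρ)) (perms (suc (suc m))) ×ℚ H false
    ≡⟨ cong₂ (λ a b → a ×ℚ H true +ℚ b ×ℚ H false)
             (children-lastIsMax q≤m σ₀-perm) (children-¬lastIsMax q≤m σ₀-perm) ⟩
  SDᵐ (suc m) (suc m) σ ×ℚ H true +ℚ SDᵐ (suc m) m σ₀ ×ℚ H false ∎
  where
  open ≡-Reasoning
  σ = insertAt q (suc m) σ₀
  σ-perm : Perm (suc m) σ
  σ-perm = ins q q≤m σ₀-perm
  term = childTerm N j f (SD N σ)

QoF-invariant : ∀ N f j {m σ σ′} → Perm m σ → Perm m σ′ → m + f ≤ N → QoF N j f σ ≡ QoF N j f σ′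
QoF-invariant N f       zero    _  _  _ = refl
QoF-invariant N zero    (suc j) _  _  _ = refl
QoF-invariant N (suc f) (suc j) [] [] _ = refl
QoF-invariant N (suc f) (suc j) {suc m}
              σ-perm@(ins {σ = σ₀} q q≤m σ₀-perm) σ′-perm@(ins {σ = σ₀′} q′ q′≤m σ₀′-perm) m+f<N =
  begin
  QoF N (suc j) (suc f) σ
    ≡⟨ QoF-by-class N j f q≤m σ₀-perm H by-class ⟩
  SDᵐ (suc m) (suc m) σ ×ℚ H true +ℚ SDᵐ (suc m) m σ₀ ×ℚ H false
    ≡⟨ cong₂ (λ a b → a ×ℚ H true +ℚ b ×ℚ H false)
             (SDᵐ-invariant σ-perm σ′-perm ≤-refl) (SDᵐ-invariant σ₀-perm σ₀′-perm (n≤1+n m)) ⟩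
  SDᵐ (suc m) (suc m) σ′ ×ℚ H true +ℚ SDᵐ (suc m) m σ₀′ ×ℚ H false
    ≡⟨ sym (QoF-by-class N j f q′≤m σ₀′-perm H by-class′) ⟩
  QoF N (suc j) (suc f) σ′ ∎
  where
  open ≡-Reasoning
  σ  = insertAt q  (suc m) σ₀
  σ′ = insertAt q′ (suc m) σ₀′
  M = suc (suc m)
  M+f≤N : M + f ≤ N
  M+f≤N = subst (_≤ N) (+-suc (suc m) f) m+f<N
  same-SD : SD N σ′ ≡ SD N σ
  same-SD = SD-invariant N σ′-perm σ-perm (≤-trans (m≤m+n (suc m) (suc f)) m+f<N)
  representative : Bool → List ℕ
  representative b = insertAt (if b then suc m else 0) M σ
  representative-perm : ∀ b → Perm M (representative b)
  representative-perm true  = ins (suc m) ≤-refl σ-perm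
  representative-perm false = ins 0 z≤n σ-perm
  lastIsMaxᵇ-representative : ∀ b → lastIsMaxᵇ (representative b) ≡ b
  lastIsMaxᵇ-representative true  = trans (lastIsMaxᵇ-insertAt ≤-refl σ-perm) (≡ᵇ-refl m)
  lastIsMaxᵇ-representative false = lastIsMaxᵇ-insertAt z≤n σ-perm
  H : Bool → ℚ
  H b = childTerm N j f (SD N σ) (representative b)
  childTerm-invariant : ∀ {ρ ρ′} → Perm M ρ → Perm M ρ′ → lastIsMaxᵇ ρ ≡ lastIsMaxᵇ ρ′ →
                        childTerm N j f (SD N σ) ρ ≡ childTerm N j f (SD N σ) ρ′
  childTerm-invariant ρ-perm ρ′-perm same-last
    rewrite SD-invariant N ρ-perm ρ′-perm (≤-trans (m≤m+n M f) M+f≤N)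
          | Win-invariant N ρ-perm ρ′-perm (≤-trans (m≤m+n M f) M+f≤N) same-last
          | QoF-invariant N f j ρ-perm ρ′-perm M+f≤N
          | QoF-invariant N f (suc j) ρ-perm ρ′-perm M+f≤N = refl
  by-class : ∀ {ρ} → Perm M ρ → childTerm N j f (SD N σ) ρ ≡ H (lastIsMaxᵇ ρ)
  by-class {ρ} ρ-perm =
    childTerm-invariant ρ-perm (representative-perm (lastIsMaxᵇ ρ)) (sym (lastIsMaxᵇ-representative (lastIsMaxᵇ ρ)))
  by-class′ : ∀ {ρ} → Perm M ρ → childTerm N j f (SD N σ′) ρ ≡ H (lastIsMaxᵇ ρ)
  by-class′ {ρ} ρ-perm = trans (cong (λ s → childTerm N j f s ρ) same-SD) (by-class ρ-perm)

Qo-invariant : ∀ N i {m ρ ρ′} → Perm m ρ → Perm m ρ′ → m ≤ N → Qo N i ρ ≡ Qo N i ρ′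
Qo-invariant N i {m} {ρ} {ρ′} ρ-perm ρ′-perm m≤N = begin
  QoF N i (N ∸ length ρ) ρ    ≡⟨ cong (λ l → QoF N i (N ∸ l) ρ) (Perm-length ρ-perm) ⟩
  QoF N i (N ∸ m) ρ           ≡⟨ QoF-invariant N (N ∸ m) i ρ-perm ρ′-perm (≤-reflexive (m+[n∸m]≡n m≤N)) ⟩
  QoF N i (N ∸ m) ρ′          ≡⟨ cong (λ l → QoF N i (N ∸ l) ρ′) (sym (Perm-length ρ′-perm)) ⟩
  QoF N i (N ∸ length ρ′) ρ′  ∎
  where open ≡-Reasoning

SameProspects : ℕ → ℕ → List ℕ → List ℕ → Set
SameProspects N i ρ ρ′ = (Q N i ρ ≡ Q N i ρ′) × (Qo N i ρ ≡ Qo N i ρ′)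

prospects-invariant : ∀ N i {m ρ ρ′} → Perm m ρ → Perm m ρ′ → m ≤ N → lastIsMaxᵇ ρ ≡ lastIsMaxᵇ ρ′ →
                      SameProspects N i ρ ρ′
prospects-invariant N i ρ-perm ρ′-perm m≤N same-last =
  cong₂ _+ℚ_ (cong₂ frac (Win-invariant N ρ-perm ρ′-perm m≤N same-last) (SD-invariant N ρ-perm ρ′-perm m≤N))
             (Qo-invariant N (i ∸ 1) ρ-perm ρ′-perm m≤N) ,
  Qo-invariant N i ρ-perm ρ′-perm m≤N

Positive-cong : ∀ {N i ρ ρ′} → SameProspects N i ρ ρ′ → Positive N i ρ ⇔ Positive N i ρ′
Positive-cong (same-Q , same-Qo) = mk⇔ (subst₂ _≤ℚ_ same-Qo same-Q) (subst₂ _≤ℚ_ (sym same-Qo) (sym same-Q))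

gAct-↭ : ∀ {τ σ} → IsPerm τ → length τ ≤ length σ → gAct τ σ ↭ σ
gAct-↭ {τ} {σ} τ↭ k≤len =
  ↭-trans (++⁺ʳ (drop k σ) (↭-trans (↭-map⁺ (at (take k σ)) τ↭) (↭-reflexive rearranged-identity)))
          (↭-reflexive (take++drop≡id k σ))
  where
  k = length τ
  rearranged-identity : map (at (take k σ)) (idPerm k) ≡ take k σ
  rearranged-identity = trans (cong (λ l → map (at (take k σ)) (idPerm l)) (sym (length-take-≤ σ k≤len)))
                              (map-at-idPerm (take k σ))

lastIsMaxᵇ-gAct : ∀ {τ σ} → IsPerm τ → length τ < length σ → lastIsMaxᵇ (gAct τ σ) ≡ lastIsMaxᵇ σ
lastIsMaxᵇ-gAct {τ} {σ} τ↭ k<len = begin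
  at (gAct τ σ) (length (gAct τ σ)) ≡ᵇ length (gAct τ σ)
    ≡⟨ cong (λ l → at (gAct τ σ) l ≡ᵇ l) (↭-length (gAct-↭ τ↭ (<⇒≤ k<len))) ⟩
  at (gAct τ σ) (length σ) ≡ᵇ length σ
    ≡⟨ cong (_≡ᵇ length σ) same-last-entry ⟩
  at σ (length σ) ≡ᵇ length σ ∎
  where
  open ≡-Reasoning
  k = length τ
  same-last-entry : at (gAct τ σ) (length σ) ≡ at σ (length σ)
  same-last-entry =
    trans (at-++-beyond (map (at (take k σ)) τ) {take k σ} (length σ)
                        (trans (length-map _ τ) (sym (length-take-≤ σ (<⇒≤ k<len))))
                        (subst (_< length σ) (sym (length-map _ τ)) k<len))
          (cong (λ l → at l (length σ)) (take++drop≡id k σ))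

gAct-idPerm : ∀ {τ} → Perm (length τ) τ → gAct τ (idPerm (length τ)) ≡ τ
gAct-idPerm {τ} τ-perm = begin
  map (at (take k (idPerm k))) τ ++ drop k (idPerm k)  ≡⟨ cong₂ (λ xs ys → map (at xs) τ ++ ys)
                                                                 (take-all k (idPerm k) k≥len) (drop-all k (idPerm k) k≥len) ⟩
  map (at (idPerm k)) τ ++ []                           ≡⟨ ++-identityʳ _ ⟩
  map (at (idPerm k)) τ                                 ≡⟨ map-id-local (All.map (at-idPerm k ∘ s≤s⁻¹) (Perm-< τ-perm)) ⟩
  τ                                                     ∎
  where
  open ≡-Reasoning
  k = length τ
  k≥len : k ≥ length (idPerm k)
  k≥len = ≤-reflexive (length-idPerm k)

lastIsMaxᵇ-idPerm : ∀ n → lastIsMaxᵇ (idPerm n) ≡ true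
lastIsMaxᵇ-idPerm n rewrite length-idPerm n | at-idPerm n (≤-refl {n}) = ≡ᵇ-refl n

LastIsLRMax⇒lastIsMaxᵇ : ∀ {τ} → Perm (length τ) τ → LastIsLRMax τ → lastIsMaxᵇ τ ≡ true
LastIsLRMax⇒lastIsMaxᵇ τ-perm (xs , x , refl , xs<x) = begin
  at (xs ++ [ x ]) (length (xs ++ [ x ])) ≡ᵇ length (xs ++ [ x ])
    ≡⟨ cong (λ l → at (xs ++ [ x ]) l ≡ᵇ l) length-∷ʳ ⟩
  at (xs ++ [ x ]) (suc (length xs)) ≡ᵇ suc (length xs)
    ≡⟨ cong (_≡ᵇ suc (length xs)) (trans (at-∷ʳ xs x) x≡max) ⟩
  suc (length xs) ≡ᵇ suc (length xs)
    ≡⟨ ≡ᵇ-refl (suc (length xs)) ⟩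
  true ∎
  where
  open ≡-Reasoning
  length-∷ʳ : length (xs ++ [ x ]) ≡ suc (length xs)
  length-∷ʳ = trans (length-++ xs) (+-comm (length xs) 1)
  perm : Perm (suc (length xs)) (xs ++ [ x ])
  perm = subst (λ l → Perm l (xs ++ [ x ])) length-∷ʳ τ-perm
  x≡max : x ≡ suc (length xs)
  x≡max with ∈-++⁻ xs (Perm-max-∈ perm)
  ... | inj₂ (here max≡x) = sym max≡x
  ... | inj₁ max∈xs       = ⊥-elim (≤⇒≯ (s≤s⁻¹ (All.lookup (Perm-< perm) (∈-++⁺ʳ xs (here refl))))
                                          (All.lookup xs<x max∈xs))

prospects-gAct : ∀ N i {τ σ} → IsPerm τ → InTo N (length τ) σ → SameProspects N i (gAct τ σ) σ
prospects-gAct N i τ↭ (σ↭ , k<len , len≤N , _) =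
  prospects-invariant N i (↭idPerm⇒Perm _ (↭-trans (gAct-↭ τ↭ (<⇒≤ k<len)) σ↭)) (IsPerm⇒Perm σ↭) len≤N
                      (lastIsMaxᵇ-gAct τ↭ k<len)

prospects-idPerm : ∀ N i {τ} → IsPerm τ → length τ < N → Eligible N τ → SameProspects N i τ (idPerm (length τ))
prospects-idPerm N i τ↭ k<N (inj₂ k≡N)   = ⊥-elim (<-irrefl k≡N k<N)
prospects-idPerm N i {τ} τ↭ k<N (inj₁ lrmax) =
  prospects-invariant N i (IsPerm⇒Perm τ↭) (↭idPerm⇒Perm (length τ) ↭-refl) (<⇒≤ k<N)
                      (trans (LastIsLRMax⇒lastIsMaxᵇ (IsPerm⇒Perm τ↭) lrmax) (sym (lastIsMaxᵇ-idPerm (length τ))))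

mainTheorem5 : (N s i : ℕ) (τ : List ℕ) → 1 ≤ N → 1 ≤ s → 1 ≤ i → i ≤ s →
    IsPerm τ → 1 ≤ length τ → length τ ≤ N ∸ 1 →
    ((σ : List ℕ) → InTo N (length τ) σ → Q N i (gAct τ σ) ≡ Q N i σ)
    × (Eligible N τ → Q N i (idPerm (length τ)) ≡ Q N i τ)
    × ((σ : List ℕ) → InTo N (length τ) σ ⊎ (σ ≡ idPerm (length τ) × Eligible N τ) →
         (Qo N i (gAct τ σ) ≡ Qo N i σ)
         × (Qbar N i (gAct τ σ) ≡ Qbar N i σ)
         × (Eligible N σ → Eligible N τ → (Positive N i σ ⇔ Positive N i (gAct τ σ))))
mainTheorem5 N s i τ 1≤N _ _ _ τ↭ _ k≤N∸1 =
  (λ σ σ∈T → proj₁ (prospects-gAct N i τ↭ σ∈T)) ,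
  (λ eligible → sym (proj₁ (prospects-idPerm N i τ↭ k<N eligible))) ,
  λ σ σ-case → consequences (prospects σ σ-case)
  where
  k<N : length τ < N
  k<N = ≤-trans (s≤s k≤N∸1) (≤-reflexive (m+[n∸m]≡n 1≤N))
  prospects : ∀ σ → InTo N (length τ) σ ⊎ (σ ≡ idPerm (length τ) × Eligible N τ) →
              SameProspects N i (gAct τ σ) σ
  prospects σ (inj₁ σ∈T)               = prospects-gAct N i τ↭ σ∈T
  prospects _ (inj₂ (refl , eligible)) = subst (λ ρ → SameProspects N i ρ (idPerm (length τ)))
                                               (sym (gAct-idPerm (IsPerm⇒Perm τ↭))) (prospects-idPerm N i τ↭ k<N eligible)
  consequences : ∀ {σ} → SameProspects N i (gAct τ σ) σ →
                 (Qo N i (gAct τ σ) ≡ Qo N i σ) × (Qbar N i (gAct τ σ) ≡ Qbar N i σ)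
                 × (Eligible N σ → Eligible N τ → (Positive N i σ ⇔ Positive N i (gAct τ σ)))
  consequences {σ} (same-Q , same-Qo) =
    same-Qo , cong₂ _⊔ℚ_ same-Q same-Qo , λ _ _ → Positive-cong {N} {i} {σ} (sym same-Q , sym same-Qo)
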